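{- Let $G$ be a finite connected graph of diameter $D(G) \geq 6$. Then $c(G) \leq \gamma(G)-1$, where $c(G)$ is the cop number of $G$ and $\gamma(G)$ is the domination number of $G$.
   Context: The game of Cops and Robbers on a finite undirected graph $G$: one player controls $k$ cops and the other a single robber. First the cops choose starting vertices (several cops may share a vertex), then the robber chooses a starting vertex. Players then alternate turns, beginning with the cops; on the cops' turn each cop moves to a vertex at distance at most $1$ from its current vertex, and on the robber's turn the robber does likewise. The cops win if at some point the robber occupies the same vertex as some cop; otherwise the robber wins. The cop number $c(G)$ is the minimum $k$ such that $k$ cops have a winning strategy. The domination number $\gamma(G)$ is the minimum size of a set $S \subseteq V(G)$ such that every vertex not in $S$ has a neighbour in $S$. $D(G)$ is the diameter of $G$. -}

module Defs where

open import Data.Nat using (ℕ; zero; suc; _≤_; _∸_)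
open import Data.Fin using (Fin)
open import Data.Fin.Subset using (Subset; _∈_; ∣_∣)
open import Data.Bool using (Bool; true; false)
open import Data.Product using (Σ; ∃; ∃-syntax; _×_; _,_)
open import Data.Sum using (_⊎_)
open import Relation.Binary.PropositionalEquality using (_≡_)

record Graph : Set where
  field
    n     : ℕ
    adj   : Fin n → Fin n → Bool
    sym   : ∀ u v → adj u v ≡ adj v u
    irrefl : ∀ u → adj u u ≡ false

module _ (G : Graph) where
  open Graph G

  V : Set
  V = Fin n

  Adj : V → V → Set
  Adj u v = adj u v ≡ true

  data Walk : V → V → ℕ → Set where
    here : ∀ {u} → Walk u u 0
    step : ∀ {u w v ℓ} → Adj u w → Walk w v ℓ → Walk u v (suc ℓ)

  Connected : Set
  Connected = ∀ u v → ∃[ ℓ ] Walk u v ℓ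

  DistAtLeast : V → V → ℕ → Set
  DistAtLeast u v d = ∀ ℓ → Walk u v ℓ → d ≤ ℓ

  DiameterAtLeast : ℕ → Set
  DiameterAtLeast d = ∃[ u ] ∃[ v ] DistAtLeast u v d

  Dominating : Subset n → Set
  Dominating S = ∀ v → v ∈ S ⊎ (∃[ u ] (u ∈ S × Adj u v))

  IsDominationNumber : ℕ → Set
  IsDominationNumber g =
    (∃[ S ] (Dominating S × ∣ S ∣ ≡ g)) × (∀ S → Dominating S → g ≤ ∣ S ∣)

  Step : V → V → Set
  Step u v = u ≡ v ⊎ Adj u v

  Cops : ℕ → Set
  Cops k = Fin k → V

  Captured : ∀ {k} → Cops k → V → Set
  Captured cs r = ∃[ i ] cs i ≡ r

  -- CopsWinFrom cs r : with cops at cs, robber at r, and the cops to move,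
  -- the cops can force a capture in finitely many moves.
  data CopsWinFrom {k : ℕ} (cs : Cops k) (r : V) : Set where
    caught : Captured cs r → CopsWinFrom cs r
    move   : (cs′ : Cops k) → (∀ i → Step (cs i) (cs′ i)) →
             (Captured cs′ r ⊎ (∀ r′ → Step r r′ → CopsWinFrom cs′ r′)) →
             CopsWinFrom cs r

  -- k cops have a winning strategy: cops place first, robber then places,
  -- then the cops move first.
  CopsWin : ℕ → Set
  CopsWin k = ∃[ cs ] (∀ r → CopsWinFrom {k} cs r)

  CopNumberAtMost : ℕ → Set
  CopNumberAtMost m = ∃[ k ] (k ≤ m × CopsWin k)

module Submission where

open import Defs
open import Data.Nat using (ℕ; zero; suc; _∸_; s≤s⁻¹)
open import Data.Nat.Properties using (≤-refl; m≤n⇒m≤1+n)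
open import Data.Fin using (Fin; zero; suc; punchIn; punchOut; _≟_)
open import Data.Fin.Properties using (punchIn-punchOut)
open import Data.Fin.Subset using (Subset; _∈_; ∣_∣)
open import Data.Vec.Functional using (_∷_; removeAt; updateAt)
open import Data.Vec.Functional.Properties using (updateAt-updates; updateAt-minimal)
open import Data.Vec as Vec using ([]; here; there)
open import Data.Bool using (true; false)
open import Data.Product using (Σ; ∃; _,_; proj₁; proj₂; map₂)
open import Data.Sum using (_⊎_; inj₁; inj₂)
open import Data.Empty using (⊥-elim)
open import Function using (_∘_)
open import Relation.Nullary using (¬_; yes; no)
open import Relation.Binary.PropositionalEquality using (_≡_; _≢_; refl; sym; trans; cong; subst)

-- Idea: a dominating set S contains dominators x of u and y of v, where dist(u, v) ≥ 6,
-- so dist(x, y) ≥ 4 and the closed neighbourhoods N[x], N[y] are at distance ≥ 2.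
-- Keep one cop on every other vertex of S and a single cop for both x and y.  A robber
-- starting in N[x] is caught at once; one starting in N[y] is chased by that cop
-- walking to y, and can never leave N[y] without entering the neighbourhood of a
-- stationary cop, since it cannot jump to N[x].

enumerate : ∀ {n} (S : Subset n) → Σ (Fin ∣ S ∣ → Fin n) λ f → ∀ {v} → v ∈ S → ∃ λ k → f k ≡ v
enumerate [] = (λ ()) , λ ()
enumerate (true Vec.∷ S) with enumerate S
... | f , onto = (zero ∷ suc ∘ f) , onto′
  where
  onto′ : ∀ {v} → v ∈ true Vec.∷ S → ∃ λ k → (zero ∷ suc ∘ f) k ≡ v
  onto′ here = zero , refl
  onto′ (there v∈S) with onto v∈S
  ... | k , refl = suc k , refl
enumerate (false Vec.∷ S) with enumerate S
... | f , onto = suc ∘ f , λ { (there v∈S) → map₂ (cong suc) (onto v∈S) }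

punchIn-cases : ∀ {n} (i k : Fin (suc n)) → k ≡ i ⊎ ∃ λ t → punchIn i t ≡ k
punchIn-cases i k with k ≟ i
... | yes k≡i = inj₁ k≡i
... | no k≢i = inj₂ (punchOut (k≢i ∘ sym) , punchIn-punchOut (k≢i ∘ sym))

module _ (G : Graph) where
  open Graph G using () renaming (sym to adj-sym)

  Step-sym : ∀ {a b} → Step G a b → Step G b a
  Step-sym (inj₁ refl) = inj₁ refl
  Step-sym {a} {b} (inj₂ ab) = inj₂ (trans (adj-sym b a) ab)

  snoc : ∀ {a b c ℓ} → Walk G a b ℓ → Adj G b c → Walk G a c (suc ℓ)
  snoc here bc = step bc here
  snoc (step ab w) c = step ab (snoc w c)

  reverse : ∀ {a b ℓ} → Walk G a b ℓ → Walk G b a ℓ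
  reverse here = here
  reverse {a} (step {w = w} aw walk) = snoc (reverse walk) (trans (adj-sym w a) aw)

  DistAtLeast-sym : ∀ {a b d} → DistAtLeast G a b d → DistAtLeast G b a d
  DistAtLeast-sym D ℓ w = D ℓ (reverse w)

  DistAtLeast-irrefl : ∀ {a d} → ¬ DistAtLeast G a a (suc d)
  DistAtLeast-irrefl D with D 0 here
  ... | ()

  DistAtLeast-stepˡ : ∀ {a a′ b d} → Step G a a′ → DistAtLeast G a b (suc d) → DistAtLeast G a′ b d
  DistAtLeast-stepˡ (inj₁ refl) D ℓ w = s≤s⁻¹ (m≤n⇒m≤1+n (D ℓ w))
  DistAtLeast-stepˡ (inj₂ aa′) D ℓ w = s≤s⁻¹ (D (suc ℓ) (step aa′ w))

  DistAtLeast-stepʳ : ∀ {a b b′ d} → Step G b b′ → DistAtLeast G a b (suc d) → DistAtLeast G a b′ d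
  DistAtLeast-stepʳ s = DistAtLeast-sym ∘ DistAtLeast-stepˡ s ∘ DistAtLeast-sym

  DistAtLeast-4⇒apart : ∀ {z z′ r r′} → DistAtLeast G z z′ 4 →
                        Step G z r → Step G r r′ → ¬ Step G z′ r′
  DistAtLeast-4⇒apart D zr rr′ z′r′ =
    DistAtLeast-irrefl (DistAtLeast-stepʳ z′r′ (DistAtLeast-stepˡ rr′ (DistAtLeast-stepˡ zr D)))

  Watched : ∀ {k} → Cops G k → V G → Set
  Watched cs w = ∃ λ t → Step G (cs t) w

  Watched-removeAt : ∀ {k} (cs : Cops G (suc k)) i {w} →
                     Watched cs w → Step G (cs i) w ⊎ Watched (removeAt cs i) w
  Watched-removeAt cs i (k , s) with punchIn-cases i k
  ... | inj₁ refl = inj₁ s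
  ... | inj₂ (t , refl) = inj₂ (t , s)

  capture : ∀ {k} {cs : Cops G k} {r} → Watched cs r → CopsWinFrom G cs r
  capture {cs = cs} {r} (t , s) = move (updateAt cs t λ _ → r) moves (inj₁ (t , updateAt-updates t cs))
    where
    moves : ∀ t′ → Step G (cs t′) (updateAt cs t (λ _ → r) t′)
    moves t′ with t′ ≟ t
    ... | yes refl = subst (Step G (cs t)) (sym (updateAt-updates t cs)) s
    ... | no t′≢t = inj₁ (sym (updateAt-minimal t′ t cs t′≢t))

  chaser-moves : ∀ {m c c′} (p : Cops G m) → Step G c c′ → ∀ t → Step G ((c ∷ p) t) ((c′ ∷ p) t)
  chaser-moves p cc′ zero = cc′
  chaser-moves p cc′ (suc t) = inj₁ refl

  chase : ∀ {m} (p : Cops G m) {z} →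
          (∀ {r r′} → Step G z r → Step G r r′ → Step G z r′ ⊎ Watched p r′) →
          ∀ {c ℓ} → Walk G c z ℓ → ∀ {r} → Step G z r → CopsWinFrom G (c ∷ p) r
  chase p escape here {r} zr = move (r ∷ p) (chaser-moves p zr) (inj₁ (zero , refl))
  chase p escape (step {w = c′} cc′ walk) zr = move (c′ ∷ p) (chaser-moves p (inj₂ cc′)) (inj₂ respond)
    where
    respond : ∀ r′ → Step G _ r′ → CopsWinFrom G (c′ ∷ p) r′
    respond r′ rr′ with escape zr rr′
    ... | inj₁ zr′ = chase p escape walk zr′
    ... | inj₂ (t , s) = capture (suc t , s)

  far-pair-win : ∀ {m x y} → Connected G → DistAtLeast G x y 4 → (p : Cops G m) →
                 (∀ w → Step G x w ⊎ Step G y w ⊎ Watched p w) → CopsWin G (suc m)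
  far-pair-win {x = x} {y} connected far p cover = x ∷ p , start
    where
    escape : ∀ {z z′} → DistAtLeast G z z′ 4 → (∀ w → Step G z w ⊎ Step G z′ w ⊎ Watched p w) →
             ∀ {r r′} → Step G z r → Step G r r′ → Step G z r′ ⊎ Watched p r′
    escape zz′ covers zr rr′ with covers _
    ... | inj₁ zr′ = inj₁ zr′
    ... | inj₂ (inj₁ z′r′) = ⊥-elim (DistAtLeast-4⇒apart zz′ zr rr′ z′r′)
    ... | inj₂ (inj₂ watched) = inj₂ watched

    cover-swapped : ∀ w → Step G y w ⊎ Step G x w ⊎ Watched p w
    cover-swapped w with cover w
    ... | inj₁ xw = inj₂ (inj₁ xw)
    ... | inj₂ (inj₁ yw) = inj₁ yw
    ... | inj₂ (inj₂ watched) = inj₂ (inj₂ watched)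

    start : ∀ r → CopsWinFrom G (x ∷ p) r
    start r with cover r
    ... | inj₁ xr = chase p (escape far cover) here xr
    ... | inj₂ (inj₁ yr) =
      chase p (escape (DistAtLeast-sym far) cover-swapped) (proj₂ (connected x y)) yr
    ... | inj₂ (inj₂ (t , s)) = capture (suc t , s)

  far-dominators-win : Connected G → ∀ {g} (f : Cops G g) → (∀ w → Watched f w) →
                       ∀ i j → DistAtLeast G (f i) (f j) 4 → CopNumberAtMost G (g ∸ 1)
  far-dominators-win connected {suc zero} f dominating zero zero far = ⊥-elim (DistAtLeast-irrefl far)
  far-dominators-win connected {suc (suc h)} f dominating i j far =
    suc h , ≤-refl , far-pair-win connected far (removeAt (removeAt f j) i′) cover
    where
    j≢i : j ≢ i
    j≢i refl = DistAtLeast-irrefl far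

    i′ : Fin (suc h)
    i′ = punchOut j≢i

    cover : ∀ w → Step G (f i) w ⊎ Step G (f j) w ⊎ Watched (removeAt (removeAt f j) i′) w
    cover w with Watched-removeAt f j (dominating w)
    ... | inj₁ yw = inj₂ (inj₁ yw)
    ... | inj₂ watched with Watched-removeAt (removeAt f j) i′ watched
    ...   | inj₁ xw = inj₁ (subst (λ k → Step G (f k) w) (punchIn-punchOut j≢i) xw)
    ...   | inj₂ watched′ = inj₂ (inj₂ watched′)

  dominating-family-win : Connected G → DiameterAtLeast G 6 →
                          ∀ {g} (f : Cops G g) → (∀ w → Watched f w) → CopNumberAtMost G (g ∸ 1)
  dominating-family-win connected (u , v , far) f dominating with dominating u | dominating v
  ... | i , xu | j , yv =
    far-dominators-win connected f dominating i j
      (DistAtLeast-stepʳ (Step-sym yv) (DistAtLeast-stepˡ (Step-sym xu) far))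

  Dominating⇒Watched : ∀ {S} → Dominating G S → ∀ w → Watched (proj₁ (enumerate S)) w
  Dominating⇒Watched {S} dominating w with dominating w
  ... | inj₁ w∈S = map₂ (λ e → inj₁ e) (proj₂ (enumerate S) w∈S)
  ... | inj₂ (s , s∈S , sw) with proj₂ (enumerate S) s∈S
  ...   | k , refl = k , inj₂ sw

theorem2 : (G : Graph) → Connected G → DiameterAtLeast G 6 →
    (g : ℕ) → IsDominationNumber G g → CopNumberAtMost G (g ∸ 1)
theorem2 G connected diameter≥6 g ((S , dominating , refl) , _) =
  dominating-family-win G connected diameter≥6 (proj₁ (enumerate S)) (Dominating⇒Watched G dominating)
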